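{- Let $G$ be a connected triangle-free graph of order $n$, radius $r$ and minimum degree $\delta\ge 3$. If $v_0$ is a centre vertex of $G$ and $X(v_0)=(n_0,n_1,\ldots,n_r)$ is its distance degree, then: (B1) $n_0=1$; (B2) $\sum_{i=0}^\infty n_i=n$; (B3) if $i>0$ and $n_i>0$, then $n_1,n_2,\ldots,n_{i-1}\ge 2$; (B4) $n_{i-1}+n_i+n_{i+1}+n_{i+2}\ge 2\delta$ for all $i\in\{1,\ldots,r-1\}$ with $i\equiv 1\pmod 4$; (B5) $n_{i-1}+n_i+n_{i+1}+n_{i+2}\ge 4\delta$ for all $i\in\{9,\ldots,r-10\}$ with $i\equiv 1\pmod 4$.
   Context: The eccentricity of a vertex is its largest distance to another vertex; the radius is the minimum eccentricity; a centre vertex has eccentricity equal to the radius (so $v_0$ has eccentricity $r$). The distance degree of $v_0$ is $(n_0,\ldots,n_r)$ where $n_i$ is the number of vertices at distance exactly $i$ from $v_0$, with the convention $n_i=0$ for $i<0$ or $i>r$. -}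

module Defs where

open import Data.Nat using (ℕ; zero; suc; _≤_; _∸_)
open import Data.Bool using (Bool; true; false; _∧_; _∨_; not; T)
open import Data.Fin using (Fin; _≟_)
open import Data.List using (List; allFin; filterᵇ; length; map; upTo)
open import Data.Bool.ListAction using (any)
open import Data.Nat.ListAction using (sum)
open import Data.Product using (Σ; ∃; _×_)
open import Data.Empty using (⊥)
open import Relation.Nullary.Decidable using (⌊_⌋)
open import Relation.Binary.PropositionalEquality using (_≡_)

record Graph (n : ℕ) : Set where
  field
    adj   : Fin n → Fin n → Bool
    sym   : ∀ u v → adj u v ≡ adj v u
    irrefl : ∀ v → adj v v ≡ false
open Graph public

module _ {n : ℕ} (G : Graph n) where

  within : ℕ → Fin n → Fin n → Bool
  within zero    u v = ⌊ u ≟ v ⌋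
  within (suc k) u v = within k u v ∨ any (λ w → adj G u w ∧ within k w v) (allFin n)

  atDist : ℕ → Fin n → Fin n → Bool
  atDist zero    u v = within zero u v
  atDist (suc i) u v = within (suc i) u v ∧ not (within i u v)

  Connected : Set
  Connected = ∀ u v → ∃ λ k → T (within k u v)

  TriangleFree : Set
  TriangleFree = ∀ a b c → T (adj G a b) → T (adj G b c) → T (adj G a c) → ⊥

  degree : Fin n → ℕ
  degree v = length (filterᵇ (adj G v) (allFin n))

  IsMinDegree : ℕ → Set
  IsMinDegree δ = (∀ v → δ ≤ degree v) × (∃ λ v → degree v ≡ δ)

  IsEccentricity : Fin n → ℕ → Set
  IsEccentricity v e = (∀ u → T (within e v u)) × (∃ λ u → T (atDist e v u))

  IsRadius : ℕ → Set
  IsRadius r = (∃ λ v → IsEccentricity v r) × (∀ v e → IsEccentricity v e → r ≤ e)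

  IsCentre : Fin n → ℕ → Set
  IsCentre v r = IsRadius r × IsEccentricity v r

  -- distance degree: n_i = number of vertices at distance exactly i from v
  -- (automatically 0 for i greater than the eccentricity of v)
  distDeg : Fin n → ℕ → ℕ
  distDeg v i = length (filterᵇ (atDist i v) (allFin n))

sumUpTo : ℕ → (ℕ → ℕ) → ℕ
sumUpTo m f = sum (map f (upTo m))

-- Layer the vertices by their distance from the centre v₀.  No vertex z can be
-- "more central" than v₀: if z is within c of v₀ and within b < t of every vertex of layer t,
-- where c + t ≤ r, then every vertex is within r - 1 of z, contradicting that r is the radius.
-- With z on a geodesic close to v₀ this rules out a singleton inner layer (B3).  For (B4), the
-- two ends of an edge between layers i and i + 1 have disjoint neighbourhoods (no triangles),
-- all inside layers i - 1, ..., i + 2.  For (B5), either some vertex of layer i + 1 is at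
-- distance more than 4 from the lower end of such an edge, and the edge below it contributes
-- a second, disjoint pair of neighbourhoods, or all of layer i + 1 is within 4 of that end, and
-- its ancestor in layer 4 is more central than v₀.
module Submission where

open import Defs hiding (sym)
open import Data.Nat
  using (ℕ; zero; suc; pred; _+_; _*_; _∸_; _%_; _<ᵇ_; _≤_; _<_; z≤n; s≤s; s≤s⁻¹; _≤?_; _<?_; _≤′_; ≤′-refl; ≤′-step)
open import Data.Nat.Properties hiding (_≟_)
open import Data.Fin using (Fin; _≟_)
open import Data.Fin.Properties using (all?; any?; ¬∀⟶∃¬)
open import Data.Bool using (Bool; true; false; _∧_; _∨_; not; T)
open import Data.Bool.Properties using (T-∧; T-∨; T-≡; T-not-≡; ¬-not)
open import Data.Bool.ListAction using (any)
open import Data.List using (List; []; _∷_; _++_; [_]; allFin; filterᵇ; length; map; upTo)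
open import Data.List.Properties using (filter-none; filter-some; filter-all; map-++; upTo-∷ʳ; length-tabulate)
open import Data.List.Relation.Unary.Any using (here; there; satisfied)
open import Data.List.Relation.Unary.Any.Properties using (any⁺; any⁻; ++⁺ˡ)
import Data.List.Relation.Unary.All as All
open import Data.List.Relation.Unary.Unique.Propositional using (Unique; _∷_; [])
open import Data.List.Relation.Unary.Unique.Propositional.Properties using (allFin⁺)
open import Data.List.Membership.Propositional using (_∈_; lose)
open import Data.List.Membership.Propositional.Properties using (∈-allFin)
open import Data.Nat.ListAction using (sum)
open import Data.Nat.ListAction.Properties using (sum-++)
open import Data.Product using (∃; ∃₂; _×_; _,_; proj₁; proj₂)
open import Data.Sum using (_⊎_; inj₁; inj₂; [_,_]′) renaming (map to ⊎-map)
open import Data.Empty using (⊥; ⊥-elim)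
open import Function using (_∘_; _⇔_; mk⇔; Equivalence)
open import Relation.Nullary using (¬_; Dec; yes; no)
open import Relation.Nullary.Decidable using (T?; ⌊_⌋; toWitness; fromWitness; map′; _×-dec_; ¬?)
open import Relation.Binary.Definitions using (tri<; tri≈; tri>)
open import Relation.Binary.PropositionalEquality using (_≡_; _≢_; refl; sym; trans; cong; cong₂; subst; module ≡-Reasoning)

open Equivalence using (to; from)

module _ {A : Set} where

  length-filterᵇ-false : ∀ xs → length (filterᵇ (λ (_ : A) → false) xs) ≡ 0
  length-filterᵇ-false [] = refl
  length-filterᵇ-false (_ ∷ xs) = length-filterᵇ-false xs

  length-filterᵇ-mono : {p q : A → Bool} → (∀ x → T (p x) → T (q x)) → ∀ xs →
                        length (filterᵇ p xs) ≤ length (filterᵇ q xs)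
  length-filterᵇ-mono p⇒q [] = z≤n
  length-filterᵇ-mono {p} {q} p⇒q (x ∷ xs) with p x in px | q x in qx
  ... | true  | true  = s≤s (length-filterᵇ-mono p⇒q xs)
  ... | true  | false = ⊥-elim (subst T qx (p⇒q x (from T-≡ px)))
  ... | false | true  = m≤n⇒m≤1+n (length-filterᵇ-mono p⇒q xs)
  ... | false | false = length-filterᵇ-mono p⇒q xs

  length-filterᵇ-cong : {p q : A → Bool} → (∀ x → T (p x) ⇔ T (q x)) → ∀ xs →
                        length (filterᵇ p xs) ≡ length (filterᵇ q xs)
  length-filterᵇ-cong p⇔q xs =
    ≤-antisym (length-filterᵇ-mono (to ∘ p⇔q) xs) (length-filterᵇ-mono (from ∘ p⇔q) xs)

  length-filterᵇ-∨ : {p q : A → Bool} → (∀ x → T (p x) → ¬ T (q x)) → ∀ xs →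
                     length (filterᵇ (λ x → p x ∨ q x) xs) ≡ length (filterᵇ p xs) + length (filterᵇ q xs)
  length-filterᵇ-∨ disj [] = refl
  length-filterᵇ-∨ {p} {q} disj (x ∷ xs) with p x in px | q x in qx
  ... | true  | true  = ⊥-elim (disj x (from T-≡ px) (from T-≡ qx))
  ... | true  | false = cong suc (length-filterᵇ-∨ disj xs)
  ... | false | true  = trans (cong suc (length-filterᵇ-∨ disj xs)) (sym (+-suc _ _))
  ... | false | false = length-filterᵇ-∨ disj xs

  length-filterᵇ-∨-≤ : (p q : A → Bool) → ∀ xs →
                       length (filterᵇ (λ x → p x ∨ q x) xs) ≤ length (filterᵇ p xs) + length (filterᵇ q xs)
  length-filterᵇ-∨-≤ p q [] = z≤n
  length-filterᵇ-∨-≤ p q (x ∷ xs) with p x | q x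
  ... | true  | true  = s≤s (≤-trans (length-filterᵇ-∨-≤ p q xs) (+-monoʳ-≤ _ (n≤1+n _)))
  ... | true  | false = s≤s (length-filterᵇ-∨-≤ p q xs)
  ... | false | true  = ≤-trans (s≤s (length-filterᵇ-∨-≤ p q xs)) (≤-reflexive (sym (+-suc _ _)))
  ... | false | false = length-filterᵇ-∨-≤ p q xs

  length-filterᵇ-any : {B : Set} (P : B → A → Bool) (ls : List B) → ∀ xs →
                       length (filterᵇ (λ x → any (λ l → P l x) ls) xs) ≤
                       sum (map (λ l → length (filterᵇ (P l) xs)) ls)
  length-filterᵇ-any P [] xs = ≤-reflexive (length-filterᵇ-false xs)
  length-filterᵇ-any P (l ∷ ls) xs =
    ≤-trans (length-filterᵇ-∨-≤ (P l) (λ x → any (λ l → P l x) ls) xs)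
            (+-monoʳ-≤ _ (length-filterᵇ-any P ls xs))

  length-filterᵇ-pos : (p : A → Bool) → ∀ xs → 0 < length (filterᵇ p xs) → ∃ λ x → T (p x)
  length-filterᵇ-pos p (x ∷ xs) pos with p x in px
  ... | true  = x , from T-≡ px
  ... | false = length-filterᵇ-pos p xs pos

  length-filterᵇ-≤1 : {p : A → Bool} {xs : List A} → Unique xs →
                      (∀ {x y} → T (p x) → T (p y) → x ≡ y) → length (filterᵇ p xs) ≤ 1
  length-filterᵇ-≤1 [] same = z≤n
  length-filterᵇ-≤1 {p} {x ∷ xs} (x∉xs ∷ unique) same with p x in px
  ... | true  = s≤s (≤-reflexive (cong length
                  (filter-none (T? ∘ p) (All.map (λ x≢y py → x≢y (same (from T-≡ px) py)) x∉xs))))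
  ... | false = length-filterᵇ-≤1 unique same

  sumUpTo-suc : ∀ m (f : ℕ → ℕ) → sumUpTo (suc m) f ≡ sumUpTo m f + f m
  sumUpTo-suc m f = begin
    sum (map f (upTo (suc m)))            ≡⟨ cong (sum ∘ map f) (sym (upTo-∷ʳ m)) ⟩
    sum (map f (upTo m ++ [ m ]))         ≡⟨ cong sum (map-++ f (upTo m) [ m ]) ⟩
    sum (map f (upTo m) ++ [ f m ])       ≡⟨ sum-++ (map f (upTo m)) [ f m ] ⟩
    sumUpTo m f + (f m + 0)               ≡⟨ cong (sumUpTo m f +_) (+-identityʳ (f m)) ⟩
    sumUpTo m f + f m                     ∎
    where open ≡-Reasoning

  sumUpTo-classes : (P : ℕ → A → Bool) (f : A → ℕ) → (∀ i x → T (P i x) ⇔ f x ≡ i) → ∀ m xs →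
                    sumUpTo m (λ i → length (filterᵇ (P i) xs)) ≡ length (filterᵇ (λ x → f x <ᵇ m) xs)
  sumUpTo-classes P f classes zero xs = sym (length-filterᵇ-false xs)
  sumUpTo-classes P f classes (suc m) xs = begin
    sumUpTo (suc m) (λ i → length (filterᵇ (P i) xs))
      ≡⟨ sumUpTo-suc m _ ⟩
    sumUpTo m (λ i → length (filterᵇ (P i) xs)) + length (filterᵇ (P m) xs)
      ≡⟨ cong (_+ _) (sumUpTo-classes P f classes m xs) ⟩
    length (filterᵇ (λ x → f x <ᵇ m) xs) + length (filterᵇ (P m) xs)
      ≡⟨ sym (length-filterᵇ-∨ disjoint xs) ⟩
    length (filterᵇ (λ x → (f x <ᵇ m) ∨ P m x) xs)
      ≡⟨ length-filterᵇ-cong split xs ⟩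
    length (filterᵇ (λ x → f x <ᵇ suc m) xs) ∎
    where
    open ≡-Reasoning
    disjoint : ∀ x → T (f x <ᵇ m) → ¬ T (P m x)
    disjoint x lt pm = <-irrefl (to (classes m x) pm) (<ᵇ⇒< (f x) m lt)
    split : ∀ x → T ((f x <ᵇ m) ∨ P m x) ⇔ T (f x <ᵇ suc m)
    split x = mk⇔ (<⇒<ᵇ ∘ [ m<n⇒m<1+n ∘ <ᵇ⇒< (f x) m , s≤s ∘ ≤-reflexive ∘ to (classes m x) ]′ ∘ to T-∨)
                  (from T-∨ ∘ ⊎-map <⇒<ᵇ (from (classes m x)) ∘ m≤n⇒m<n∨m≡n ∘ s≤s⁻¹ ∘ <ᵇ⇒< (f x) (suc m))

module _ {n : ℕ} where

  length-filterᵇ-allFin-≥1 : (p : Fin n → Bool) {a : Fin n} → T (p a) → 1 ≤ length (filterᵇ p (allFin n))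
  length-filterᵇ-allFin-≥1 p {a} pa = filter-some (T? ∘ p) (lose (∈-allFin a) pa)

  length-filterᵇ-≟ : (a : Fin n) → length (filterᵇ (λ v → ⌊ a ≟ v ⌋) (allFin n)) ≡ 1
  length-filterᵇ-≟ a = ≤-antisym (length-filterᵇ-≤1 (allFin⁺ n) same)
                                 (length-filterᵇ-allFin-≥1 _ (fromWitness {a? = a ≟ a} refl))
    where
    same : ∀ {x y} → T ⌊ a ≟ x ⌋ → T ⌊ a ≟ y ⌋ → x ≡ y
    same ax ay = trans (sym (toWitness ax)) (toWitness ay)

  length-filterᵇ-allFin-≥2 : (p : Fin n → Bool) {a b : Fin n} → a ≢ b → T (p a) → T (p b) →
                             2 ≤ length (filterᵇ p (allFin n))
  length-filterᵇ-allFin-≥2 p {a} {b} a≢b pa pb = begin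
    1 + 1
      ≤⟨ +-mono-≤ (length-filterᵇ-allFin-≥1 (is a) (is-refl a)) (length-filterᵇ-allFin-≥1 (is b) (is-refl b)) ⟩
    length (filterᵇ (is a) (allFin n)) + length (filterᵇ (is b) (allFin n))
      ≡⟨ sym (length-filterᵇ-∨ distinct (allFin n)) ⟩
    length (filterᵇ (λ v → is a v ∨ is b v) (allFin n))
      ≤⟨ length-filterᵇ-mono into-p (allFin n) ⟩
    length (filterᵇ p (allFin n)) ∎
    where
    open ≤-Reasoning
    is : Fin n → Fin n → Bool
    is x v = ⌊ x ≟ v ⌋
    is-refl : ∀ x → T (is x x)
    is-refl x = fromWitness {a? = x ≟ x} refl
    distinct : ∀ v → T (is a v) → ¬ T (is b v)
    distinct v av bv = a≢b (trans (toWitness av) (sym (toWitness bv)))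
    into-p : ∀ v → T (is a v ∨ is b v) → T (p v)
    into-p v h with to (T-∨ {is a v}) h
    ... | inj₁ av = subst (T ∘ p) (toWitness {a? = a ≟ v} av) pa
    ... | inj₂ bv = subst (T ∘ p) (toWitness {a? = b ≟ v} bv) pb

module Distance {n : ℕ} (G : Graph n) where

  -- Records rather than T (adj G u v) etc., so that the vertices and radii stay inferable.
  record Adj (u v : Fin n) : Set where
    constructor mkAdj
    field unAdj : T (adj G u v)

  record Within (k : ℕ) (u v : Fin n) : Set where
    constructor mkWithin
    field unWithin : T (within G k u v)

  record AtDist (i : ℕ) (u v : Fin n) : Set where
    constructor mkAtDist
    field unAtDist : T (atDist G i u v)

  open Adj public
  open Within public
  open AtDist public

  within? : ∀ k u v → Dec (Within k u v)
  within? k u v = map′ mkWithin unWithin (T? (within G k u v))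

  atDist? : ∀ i u v → Dec (AtDist i u v)
  atDist? i u v = map′ mkAtDist unAtDist (T? (atDist G i u v))

  adj-sym : ∀ {u v} → Adj u v → Adj v u
  adj-sym {u} {v} (mkAdj a) = mkAdj (subst T (Graph.sym G u v) a)

  within-refl : ∀ {u} → Within 0 u u
  within-refl {u} = mkWithin (fromWitness {a? = u ≟ u} refl)

  within-zero⁻ : ∀ {u v} → Within 0 u v → u ≡ v
  within-zero⁻ {u} {v} (mkWithin h) = toWitness {a? = u ≟ v} h

  within-suc : ∀ {k u v} → Within k u v → Within (suc k) u v
  within-suc (mkWithin h) = mkWithin (from T-∨ (inj₁ h))

  adj-within : ∀ {k u w v} → Adj u w → Within k w v → Within (suc k) u v
  adj-within {k} {u} {w} {v} (mkAdj a) (mkWithin h) =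
    mkWithin (from (T-∨ {within G k u v}) (inj₂ (any⁺ _ (lose (∈-allFin w) (from T-∧ (a , h))))))

  within-suc⁻ : ∀ {k u v} → Within (suc k) u v → Within k u v ⊎ ∃ λ w → Adj u w × Within k w v
  within-suc⁻ {k} {u} {v} (mkWithin h) with to (T-∨ {within G k u v}) h
  ... | inj₁ h′ = inj₁ (mkWithin h′)
  ... | inj₂ h′ with satisfied (any⁻ (λ w → adj G u w ∧ within G k w v) (allFin n) h′)
  ... | w , uwv = let uw , wv = to (T-∧ {adj G u w}) uwv in inj₂ (w , mkAdj uw , mkWithin wv)

  within-mono : ∀ {k k′ u v} → k ≤ k′ → Within k u v → Within k′ u v
  within-mono k≤k′ = go (≤⇒≤′ k≤k′)
    where
    go : ∀ {k k′ u v} → k ≤′ k′ → Within k u v → Within k′ u v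
    go ≤′-refl h = h
    go (≤′-step k≤′k′) h = within-suc (go k≤′k′ h)

  within-+ : ∀ {a b u w v} → Within a u w → Within b w v → Within (a + b) u v
  within-+ {zero} uw wv rewrite within-zero⁻ uw = wv
  within-+ {suc a} uw wv with within-suc⁻ uw
  ... | inj₁ uw′ = within-suc (within-+ uw′ wv)
  ... | inj₂ (x , ux , xw) = adj-within ux (within-+ xw wv)

  within-trans : ∀ {a b c u w v} → Within a u w → Within b w v → a + b ≤ c → Within c u v
  within-trans uw wv a+b≤c = within-mono a+b≤c (within-+ uw wv)

  adj⇒within : ∀ {u v} → Adj u v → Within 1 u v
  adj⇒within uv = adj-within uv within-refl

  within-sym : ∀ {k u v} → Within k u v → Within k v u
  within-sym {zero} uv rewrite within-zero⁻ uv = within-refl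
  within-sym {suc k} uv with within-suc⁻ uv
  ... | inj₁ uv′ = within-suc (within-sym uv′)
  ... | inj₂ (w , uw , wv) = within-trans (within-sym wv) (adj⇒within (adj-sym uw)) (≤-reflexive (+-comm k 1))

  atDist⇒within : ∀ {i u v} → AtDist i u v → Within i u v
  atDist⇒within {zero} (mkAtDist h) = mkWithin h
  atDist⇒within {suc i} {u} {v} (mkAtDist h) = mkWithin (proj₁ (to (T-∧ {within G (suc i) u v}) h))

  atDist⇒¬within : ∀ {i j u v} → AtDist i u v → j < i → ¬ Within j u v
  atDist⇒¬within {suc i} {j} {u} {v} (mkAtDist h) (s≤s j≤i) uv =
    subst T (to T-not-≡ (proj₂ (to (T-∧ {within G (suc i) u v}) h))) (unWithin (within-mono j≤i uv))

  within⇒atDist : ∀ {i u v} → Within (suc i) u v → ¬ Within i u v → AtDist (suc i) u v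
  within⇒atDist (mkWithin h) ¬uv = mkAtDist (from T-∧ (h , from T-not-≡ (¬-not (¬uv ∘ mkWithin ∘ from T-≡))))

  atDist-unique : ∀ {i j u v} → AtDist i u v → AtDist j u v → i ≡ j
  atDist-unique {i} {j} i-uv j-uv with <-cmp i j
  ... | tri< i<j _ _ = ⊥-elim (atDist⇒¬within j-uv i<j (atDist⇒within i-uv))
  ... | tri≈ _ i≡j _ = i≡j
  ... | tri> _ _ j<i = ⊥-elim (atDist⇒¬within i-uv j<i (atDist⇒within j-uv))

  within⇒atDist-≤ : ∀ {k u v} → Within k u v → ∃ λ l → l ≤ k × AtDist l u v
  within⇒atDist-≤ {zero} (mkWithin h) = 0 , z≤n , mkAtDist h
  within⇒atDist-≤ {suc k} {u} {v} uv with within? k u v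
  ... | yes uv′ = let l , l≤k , l-uv = within⇒atDist-≤ uv′ in l , m≤n⇒m≤1+n l≤k , l-uv
  ... | no ¬uv′ = suc k , ≤-refl , within⇒atDist uv ¬uv′

  adj-atDist-≤ : ∀ {a b i j v} → Adj a b → AtDist i v a → AtDist j v b → j ≤ suc i
  adj-atDist-≤ {i = i} {j} ab i-va j-vb with j ≤? suc i
  ... | yes j≤1+i = j≤1+i
  ... | no j≰1+i = ⊥-elim (atDist⇒¬within j-vb (≰⇒> j≰1+i)
                      (within-trans (atDist⇒within i-va) (adj⇒within ab) (≤-reflexive (+-comm i 1))))

  predecessor : ∀ {j v y} → AtDist (suc j) v y → ∃ λ x → Adj x y × AtDist j v x
  predecessor {j} j+1-vy with within-suc⁻ (within-sym (atDist⇒within j+1-vy))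
  ... | inj₁ yv = ⊥-elim (atDist⇒¬within j+1-vy ≤-refl (within-sym yv))
  ... | inj₂ (x , yx , xv) with within⇒atDist-≤ (within-sym xv)
  ... | l , l≤j , l-vx = x , adj-sym yx , subst (λ l → AtDist l _ x) l≡j l-vx
    where
    l≡j : l ≡ j
    l≡j = ≤-antisym l≤j (s≤s⁻¹ (adj-atDist-≤ (adj-sym yx) l-vx j+1-vy))

  geodesic-point : ∀ {k m v u} → m ≤ k → AtDist k v u →
                   ∃ λ w → AtDist m v w × ∃ λ d → m + d ≡ k × Within d w u
  geodesic-point {zero} {u = u} z≤n vu = u , vu , 0 , refl , within-refl
  geodesic-point {suc k} {m} {u = u} m≤k+1 vu with m≤n⇒m<n∨m≡n m≤k+1
  ... | inj₂ refl = u , vu , 0 , +-identityʳ m , within-refl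
  ... | inj₁ (s≤s m≤k) with predecessor vu
  ... | x , xu , vx with geodesic-point m≤k vx
  ... | w , vw , d , m+d≡k , wx =
        w , vw , suc d , trans (+-suc m d) (cong suc m+d≡k) ,
        within-trans wx (adj⇒within xu) (≤-reflexive (+-comm d 1))

  eccentricity-≤ : ∀ {k z} → (∀ u → Within k z u) → ∃ λ e → e ≤ k × IsEccentricity G z e
  eccentricity-≤ {zero} {z} z→ = 0 , z≤n , unWithin ∘ z→ , z , unWithin (within-refl {z})
  eccentricity-≤ {suc k} {z} z→ with all? (within? k z)
  ... | yes z→′ = let e , e≤k , ecc = eccentricity-≤ z→′ in e , m≤n⇒m≤1+n e≤k , ecc
  ... | no ¬z→′ = let u , ¬zu = ¬∀⟶∃¬ n _ (within? k z) ¬z→′ in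
                  suc k , ≤-refl , unWithin ∘ z→ , u , unAtDist (within⇒atDist (z→ u) ¬zu)

  neighbour-level : ∀ {a b i v} → Adj a b → AtDist i v a →
                    ∃ λ j → j ∈ (i ∸ 1 ∷ i ∷ suc i ∷ []) × AtDist j v b
  neighbour-level {i = i} ab i-va
    with within⇒atDist-≤ (within-trans (atDist⇒within i-va) (adj⇒within ab) (≤-reflexive (+-comm i 1)))
  ... | j , j≤1+i , j-vb with m≤n⇒m<n∨m≡n j≤1+i
  ... | inj₂ refl = j , there (there (here refl)) , j-vb
  ... | inj₁ (s≤s j≤i) with m≤n⇒m<n∨m≡n j≤i
  ... | inj₂ refl = j , there (here refl) , j-vb
  ... | inj₁ j<i = j , here (cong (_∸ 1) (sym (≤-antisym (adj-atDist-≤ (adj-sym ab) j-vb i-va) j<i))) , j-vb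

  edgeNbhd : Fin n → Fin n → Fin n → Bool
  edgeNbhd x y w = adj G x w ∨ adj G y w

  edgeNbhd-within-2 : ∀ {x y w} → Adj x y → T (edgeNbhd x y w) → Within 2 x w × Within 2 y w
  edgeNbhd-within-2 {x} xy h with to (T-∨ {adj G x _}) h
  ... | inj₁ xw = within-mono (s≤s z≤n) (adj⇒within (mkAdj xw)) ,
                  within-trans (adj⇒within (adj-sym xy)) (adj⇒within (mkAdj xw)) ≤-refl
  ... | inj₂ yw = within-trans (adj⇒within xy) (adj⇒within (mkAdj yw)) ≤-refl ,
                  within-mono (s≤s z≤n) (adj⇒within (mkAdj yw))

module _ {n : ℕ} (G : Graph n) (triangle-free : TriangleFree G) where
  open Distance G

  adjacent-degree-sum : ∀ {x y} → Adj x y →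
                        degree G x + degree G y ≡ length (filterᵇ (edgeNbhd x y) (allFin n))
  adjacent-degree-sum {x} {y} (mkAdj xy) =
    sym (length-filterᵇ-∨ (λ w xw yw → triangle-free x y w xy yw xw) (allFin n))

module Window {n : ℕ} (G : Graph n) (triangle-free : TriangleFree G) (v₀ : Fin n) where
  open Distance G

  X : ℕ → ℕ
  X = distDeg G v₀

  windowLevels : ℕ → List ℕ
  windowLevels i = i ∸ 1 ∷ i ∷ suc i ∷ suc (suc i) ∷ []

  window : ℕ → Fin n → Bool
  window i w = any (λ l → atDist G l v₀ w) (windowLevels i)

  window-count : ∀ i → length (filterᵇ (window i) (allFin n)) ≤ X (i ∸ 1) + X i + X (i + 1) + X (i + 2)
  window-count i = begin
    length (filterᵇ (window i) (allFin n))
      ≤⟨ length-filterᵇ-any (λ l w → atDist G l v₀ w) (windowLevels i) (allFin n) ⟩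
    X (i ∸ 1) + (X i + (X (suc i) + (X (suc (suc i)) + 0)))
      ≡⟨ cong (λ t → X (i ∸ 1) + (X i + t)) tail-sum ⟩
    X (i ∸ 1) + (X i + (X (i + 1) + X (i + 2)))
      ≡⟨ sym (+-assoc (X (i ∸ 1)) (X i) _) ⟩
    X (i ∸ 1) + X i + (X (i + 1) + X (i + 2))
      ≡⟨ sym (+-assoc (X (i ∸ 1) + X i) _ _) ⟩
    X (i ∸ 1) + X i + X (i + 1) + X (i + 2) ∎
    where
    open ≤-Reasoning
    tail-sum : X (suc i) + (X (suc (suc i)) + 0) ≡ X (i + 1) + X (i + 2)
    tail-sum = cong₂ (λ a b → X a + b) (+-comm 1 i) (trans (+-identityʳ _) (cong X (+-comm 2 i)))

  edgeNbhd⊆window : ∀ {i x y} → Adj x y → AtDist i v₀ x → AtDist (suc i) v₀ y →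
                    ∀ w → T (edgeNbhd x y w) → T (window i w)
  edgeNbhd⊆window {i} {x} xy i-x i+1-y w h with to (T-∨ {adj G x w}) h
  ... | inj₁ xw = let j , j∈ , j-w = neighbour-level (mkAdj xw) i-x in
                  any⁺ (λ l → atDist G l v₀ w) (lose (++⁺ˡ {ys = [ suc (suc i) ]} j∈) (unAtDist j-w))
  ... | inj₂ yw = let j , j∈ , j-w = neighbour-level (mkAdj yw) i+1-y in
                  any⁺ (λ l → atDist G l v₀ w) (lose (there {x = i ∸ 1} j∈) (unAtDist j-w))

  edge-window-bound : ∀ {i x y} → Adj x y → AtDist i v₀ x → AtDist (suc i) v₀ y →
                      degree G x + degree G y ≤ length (filterᵇ (window i) (allFin n))
  edge-window-bound xy i-x i+1-y =
    ≤-trans (≤-reflexive (adjacent-degree-sum G triangle-free xy))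
            (length-filterᵇ-mono (edgeNbhd⊆window xy i-x i+1-y) (allFin n))

  far-edges-window-bound : ∀ {i x₁ y₁ x₂ y₂} →
    Adj x₁ y₁ → AtDist i v₀ x₁ → AtDist (suc i) v₀ y₁ →
    Adj x₂ y₂ → AtDist i v₀ x₂ → AtDist (suc i) v₀ y₂ → ¬ Within 4 x₁ y₂ →
    (degree G x₁ + degree G y₁) + (degree G x₂ + degree G y₂) ≤ length (filterᵇ (window i) (allFin n))
  far-edges-window-bound {i} {x₁} {y₁} {x₂} {y₂} x₁y₁ i-x₁ i+1-y₁ x₂y₂ i-x₂ i+1-y₂ far = begin
    (degree G x₁ + degree G y₁) + (degree G x₂ + degree G y₂)
      ≡⟨ cong₂ _+_ (adjacent-degree-sum G triangle-free x₁y₁)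
                   (adjacent-degree-sum G triangle-free x₂y₂) ⟩
    length (filterᵇ (edgeNbhd x₁ y₁) (allFin n)) + length (filterᵇ (edgeNbhd x₂ y₂) (allFin n))
      ≡⟨ sym (length-filterᵇ-∨ disjoint (allFin n)) ⟩
    length (filterᵇ (λ w → edgeNbhd x₁ y₁ w ∨ edgeNbhd x₂ y₂ w) (allFin n))
      ≤⟨ length-filterᵇ-mono ⊆window (allFin n) ⟩
    length (filterᵇ (window i) (allFin n)) ∎
    where
    open ≤-Reasoning
    disjoint : ∀ w → T (edgeNbhd x₁ y₁ w) → ¬ T (edgeNbhd x₂ y₂ w)
    disjoint w h₁ h₂ = far (within-trans (proj₁ (edgeNbhd-within-2 x₁y₁ h₁))
                                         (within-sym (proj₂ (edgeNbhd-within-2 x₂y₂ h₂))) ≤-refl)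
    ⊆window : ∀ w → T (edgeNbhd x₁ y₁ w ∨ edgeNbhd x₂ y₂ w) → T (window i w)
    ⊆window w h with to (T-∨ {edgeNbhd x₁ y₁ w}) h
    ... | inj₁ h₁ = edgeNbhd⊆window x₁y₁ i-x₁ i+1-y₁ w h₁
    ... | inj₂ h₂ = edgeNbhd⊆window x₂y₂ i-x₂ i+1-y₂ w h₂

module Centre {n : ℕ} (G : Graph n) {r : ℕ} {v₀ : Fin n} (centre : IsCentre G v₀ r) where
  open Distance G

  layer : ∀ u → ∃ λ l → l ≤ r × AtDist l v₀ u
  layer u = within⇒atDist-≤ (mkWithin (proj₁ (proj₂ centre) u))

  atDist-≤-radius : ∀ {i u} → AtDist i v₀ u → i ≤ r
  atDist-≤-radius {u = u} i-u = let l , l≤r , l-u = layer u in subst (_≤ r) (atDist-unique l-u i-u) l≤r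

  radius-≤ : ∀ {k z} → (∀ u → Within k z u) → r ≤ k
  radius-≤ z→ = let e , e≤k , ecc = eccentricity-≤ z→ in ≤-trans (proj₂ (proj₁ centre) _ e ecc) e≤k

  no-shortcut : ∀ {b c t z} → Within c z v₀ → (∀ y → AtDist t v₀ y → Within b z y) → c + t ≤ r → b < t → ⊥
  no-shortcut {b} {c} {t} {z} zv₀ z→layer c+t≤r b<t = n≰pred[n] 0<r (radius-≤ z→)
    where
    n≰pred[n] : ∀ {m} → 0 < m → ¬ m ≤ pred m
    n≰pred[n] {suc m} _ = 1+n≰n
    0<r : 0 < r
    0<r = <-≤-trans (<-≤-trans (≤-<-trans z≤n b<t) (m≤n+m t c)) c+t≤r
    z→ : ∀ u → Within (pred r) z u
    z→ u with layer u
    ... | l , l≤r , l-u with l <? t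
    ... | yes l<t = within-trans zv₀ (atDist⇒within l-u) (<⇒≤pred (<-≤-trans (+-monoʳ-< c l<t) c+t≤r))
    ... | no l≮t with geodesic-point (≮⇒≥ l≮t) l-u
    ... | y , t-y , d , t+d≡l , yu =
          within-trans (z→layer y t-y) yu
                       (<⇒≤pred (<-≤-trans (+-monoˡ-< d b<t) (≤-trans (≤-reflexive t+d≡l) l≤r)))

  inner-layer-not-singleton : ∀ {j w} → 1 ≤ j → j < r → AtDist j v₀ w → ¬ (∀ y → AtDist j v₀ y → y ≡ w)
  inner-layer-not-singleton 1≤j j<r j-w only with geodesic-point 1≤j j-w
  ... | z , 1-z , d , 1+d≡j , zw =
        no-shortcut (within-sym (atDist⇒within 1-z)) (λ y j-y → subst (Within d z) (sym (only y j-y)) zw)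
                    j<r (≤-reflexive 1+d≡j)

  edge-between-layers : ∀ {i} → suc i ≤ r → ∃₂ λ x y → Adj x y × AtDist i v₀ x × AtDist (suc i) v₀ y
  edge-between-layers i+1≤r with proj₂ (proj₂ centre)
  ... | u , r-u with geodesic-point i+1≤r (mkAtDist r-u)
  ... | y , i+1-y , _ with predecessor i+1-y
  ... | x , xy , i-x = x , y , xy , i-x , i+1-y

  far-vertex : ∀ {i x} → 4 ≤ i → i + 5 ≤ r → AtDist i v₀ x → ∃ λ y → AtDist (suc i) v₀ y × ¬ Within 4 x y
  far-vertex {i} {x} 4≤i i+5≤r i-x with any? (λ y → atDist? (suc i) v₀ y ×-dec ¬? (within? 4 x y))
  ... | yes found = found
  ... | no none with geodesic-point 4≤i i-x
  ... | z , 4-z , d , 4+d≡i , zx =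
        ⊥-elim (no-shortcut (within-sym (atDist⇒within 4-z)) z→layer
                            (≤-trans (≤-reflexive (+-comm 5 i)) i+5≤r)
                            (s≤s (≤-reflexive (trans (+-comm d 4) 4+d≡i))))
    where
    z→layer : ∀ y → AtDist (suc i) v₀ y → Within (d + 4) z y
    z→layer y i+1-y with within? 4 x y
    ... | yes xy = within-trans zx xy ≤-refl
    ... | no ¬xy = ⊥-elim (none (y , i+1-y , ¬xy))

  layer-sizes-sum : sumUpTo (r + 1) (distDeg G v₀) ≡ n
  layer-sizes-sum = begin
    sumUpTo (r + 1) (distDeg G v₀)
      ≡⟨ sumUpTo-classes _ depth classes (r + 1) (allFin n) ⟩
    length (filterᵇ (λ u → depth u <ᵇ r + 1) (allFin n))
      ≡⟨ cong length (filter-all _ (All.universal below (allFin n))) ⟩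
    length (allFin n)
      ≡⟨ length-tabulate (λ u → u) ⟩
    n ∎
    where
    open ≡-Reasoning
    depth : Fin n → ℕ
    depth = proj₁ ∘ layer
    classes : ∀ i u → T (atDist G i v₀ u) ⇔ depth u ≡ i
    classes i u = mk⇔ (λ i-u → atDist-unique (proj₂ (proj₂ (layer u))) (mkAtDist i-u))
                      (λ { refl → unAtDist (proj₂ (proj₂ (layer u))) })
    below : ∀ u → T (depth u <ᵇ r + 1)
    below u = <⇒<ᵇ (≤-trans (s≤s (proj₁ (proj₂ (layer u)))) (≤-reflexive (+-comm 1 r)))

  inner-layer-≥2 : ∀ {i j} → 0 < distDeg G v₀ i → 1 ≤ j → j < i → 2 ≤ distDeg G v₀ j
  inner-layer-≥2 {i} {j} nonempty 1≤j j<i with length-filterᵇ-pos _ (allFin n) nonempty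
  ... | u , i-u with geodesic-point (<⇒≤ j<i) (mkAtDist i-u)
  ... | w , j-w , _ with 2 ≤? distDeg G v₀ j
  ... | yes 2≤ = 2≤
  ... | no 2≰ =
        ⊥-elim (inner-layer-not-singleton 1≤j (<-≤-trans j<i (atDist-≤-radius (mkAtDist i-u))) j-w only)
    where
    only : ∀ y → AtDist j v₀ y → y ≡ w
    only y j-y with y ≟ w
    ... | yes y≡w = y≡w
    ... | no y≢w = ⊥-elim (2≰ (length-filterᵇ-allFin-≥2 _ y≢w (unAtDist j-y) (unAtDist j-w)))

module WindowBounds {n : ℕ} (G : Graph n) (triangle-free : TriangleFree G) {r : ℕ} {v₀ : Fin n}
                    (centre : IsCentre G v₀ r) {δ : ℕ} (min-degree : IsMinDegree G δ) where
  open Distance G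
  open Centre G centre
  open Window G triangle-free v₀

  2δ≤degree-sum : ∀ x y → 2 * δ ≤ degree G x + degree G y
  2δ≤degree-sum x y = ≤-trans (≤-reflexive (cong (δ +_) (+-identityʳ δ)))
                              (+-mono-≤ (proj₁ min-degree x) (proj₁ min-degree y))

  window-≥-2δ : ∀ {i} → suc i ≤ r → 2 * δ ≤ length (filterᵇ (window i) (allFin n))
  window-≥-2δ i+1≤r = let x , y , xy , i-x , i+1-y = edge-between-layers i+1≤r in
                      ≤-trans (2δ≤degree-sum x y) (edge-window-bound xy i-x i+1-y)

  window-≥-4δ : ∀ {i} → 4 ≤ i → i + 5 ≤ r → 4 * δ ≤ length (filterᵇ (window i) (allFin n))
  window-≥-4δ {i} 4≤i i+5≤r with edge-between-layers (≤-trans (m≤m+n (suc i) 4) (≤-trans (≤-reflexive (sym (+-suc i 4))) i+5≤r))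
  ... | x₁ , y₁ , x₁y₁ , i-x₁ , i+1-y₁ with far-vertex 4≤i i+5≤r i-x₁
  ... | y₂ , i+1-y₂ , far with predecessor i+1-y₂
  ... | x₂ , x₂y₂ , i-x₂ = begin
    4 * δ
      ≡⟨ *-distribʳ-+ δ 2 2 ⟩
    2 * δ + 2 * δ
      ≤⟨ +-mono-≤ (2δ≤degree-sum x₁ y₁) (2δ≤degree-sum x₂ y₂) ⟩
    (degree G x₁ + degree G y₁) + (degree G x₂ + degree G y₂)
      ≤⟨ far-edges-window-bound x₁y₁ i-x₁ i+1-y₁ x₂y₂ i-x₂ i+1-y₂ far ⟩
    length (filterᵇ (window i) (allFin n)) ∎
    where open ≤-Reasoning

≤∸⇒+≤ : ∀ {i m} k → 0 < i → i ≤ m ∸ k → i + k ≤ m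
≤∸⇒+≤ {i} {m} k 0<i i≤m∸k with k ≤? m
... | yes k≤m = m≤o∸n⇒m+n≤o i k≤m i≤m∸k
... | no k≰m = ⊥-elim (<-irrefl refl
                (<-≤-trans 0<i (≤-trans i≤m∸k (≤-reflexive (m≤n⇒m∸n≡0 (<⇒≤ (≰⇒> k≰m)))))))

proposition4p3 : (n : ℕ) (G : Graph n) (r δ : ℕ) (v₀ : Fin n) →
    Connected G → TriangleFree G → IsMinDegree G δ → 3 ≤ δ →
    IsCentre G v₀ r →
    let X = distDeg G v₀ in
    (X 0 ≡ 1)
    × (sumUpTo (r + 1) X ≡ n)
    × (∀ i → 0 < i → 0 < X i → ∀ j → 1 ≤ j → j < i → 2 ≤ X j)
    × (∀ i → 1 ≤ i → i ≤ r ∸ 1 → i % 4 ≡ 1 →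
         2 * δ ≤ X (i ∸ 1) + X i + X (i + 1) + X (i + 2))
    × (∀ i → 9 ≤ i → i ≤ r ∸ 10 → i % 4 ≡ 1 →
         4 * δ ≤ X (i ∸ 1) + X i + X (i + 1) + X (i + 2))
proposition4p3 n G r δ v₀ _ triangle-free min-degree _ centre =
    length-filterᵇ-≟ v₀
  , layer-sizes-sum
  , (λ i _ nonempty j 1≤j j<i → inner-layer-≥2 nonempty 1≤j j<i)
  , (λ i 1≤i i≤r∸1 _ → ≤-trans (window-≥-2δ (≤-trans (≤-reflexive (+-comm 1 i)) (≤∸⇒+≤ 1 1≤i i≤r∸1)))
                               (window-count i))
  , (λ i 9≤i i≤r∸10 _ → ≤-trans (window-≥-4δ (≤-trans (m≤m+n 4 5) 9≤i)
                                              (≤-trans (+-monoʳ-≤ i (m≤m+n 5 5))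
                                                       (≤∸⇒+≤ 10 (≤-trans (m≤m+n 1 8) 9≤i) i≤r∸10)))
                                (window-count i))
  where
  open Centre G centre
  open Window G triangle-free v₀
  open WindowBounds G triangle-free centre min-degree
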